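{- Let $\tau:S_{0}\cup S_{1}\to\omega$ be given by $\tau(w)=|w|_{v}$. Let $D\subseteq S_{0}$ be a $J$-set in $(S_{0},\cdot)$ and let $\langle x_{n}\rangle_{n=1}^{\infty}$ be a sequence in $\mathbb{N}$. Then there exists a sequence $\langle w_{n}\rangle_{n=1}^{\infty}$ in $S_{1}$ such that $\{w_{n}(a):a\in\mathbb{A}_{n}\}\subseteq D$ for all $n\in\mathbb{N}$, and for each finite nonempty $G\subseteq\mathbb{N}$, $\sum_{n\in G}\tau(w_{n})\in\mathrm{FS}(\langle x_{n}\rangle_{n=1}^{\infty})$.
   Context: Let $\mathbb{A}_{1}\subseteq\mathbb{A}_{2}\subseteq\cdots$ be an increasing sequence of finite nonempty alphabets and $\mathbb{A}=\bigcup_{i}\mathbb{A}_{i}$; $\omega=\mathbb{N}\cup\{0\}$. $S_{0}$ is the set of all nonempty finite words over $\mathbb{A}$, a semigroup under concatenation. Let $v$ be a variable not in $\mathbb{A}$; $S_{1}$ is the set of words over $\mathbb{A}\cup\{v\}$ in which $v$ occurs at least once, and $|w|_{v}$ is the number of occurrences of $v$ in $w$ (so $\tau$ vanishes on $S_0$). For $w\in S_{1}$ and $a\in\mathbb{A}$, $w(a)$ is obtained by replacing each occurrence of $v$ by $a$. $\mathrm{FS}(\langle x_{n}\rangle)=\{\sum_{n\in H}x_{n}:H\subseteq\mathbb{N}\text{ finite nonempty}\}$. For a semigroup $S$, a set $B\subseteq S$ is a $J$-set if for every finite nonempty set $F$ of sequences $f:\mathbb{N}\to S$ there exist $m\in\mathbb{N}$,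 $a_{1},\dots,a_{m+1}\in S$ and $t_{1}<\cdots<t_{m}$ in $\mathbb{N}$ with $a_{1}f(t_{1})\cdots a_{m}f(t_{m})a_{m+1}\in B$ for all $f\in F$. -}

module Defs where

open import Data.Nat using (ℕ; zero; suc; _+_; _<_; _≤_)
open import Data.Fin using (Fin; zero; suc)
open import Data.List using (List; []; _∷_)
open import Data.List.NonEmpty using (List⁺; _∷_; toList; _⁺++⁺_) renaming (map to map⁺)
open import Data.List.Membership.Propositional using (_∈_)
open import Data.List.Relation.Unary.Any using (Any)
open import Data.Maybe using (Maybe; just; nothing; fromMaybe)
open import Data.Product using (Σ; ∃; ∃-syntax; _×_)
open import Relation.Binary.PropositionalEquality using (_≡_)

-- Sequences indexed by ℕ = {0,1,2,...}; index n here corresponds to index n+1 in the paper.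

record Alphabets (A : Set) : Set where
  field
    alph      : ℕ → List⁺ A
    increasing : ∀ n (a : A) → a ∈ toList (alph n) → a ∈ toList (alph (suc n))
    covers    : ∀ (a : A) → ∃[ n ] (a ∈ toList (alph n))

-- S₀ : nonempty finite words over A (semigroup under concatenation _⁺++⁺_)
S₀ : Set → Set
S₀ A = List⁺ A

-- S₁ : words over A ∪ {v} (v = nothing) in which v occurs at least once
record S₁ (A : Set) : Set where
  constructor mkS₁
  field
    word   : List⁺ (Maybe A)
    hasVar : Any (_≡ nothing) (toList word)
open S₁ public

subst₁ : {A : Set} → S₁ A → A → S₀ A
subst₁ w a = map⁺ (fromMaybe a) (word w)

countV : {A : Set} → List (Maybe A) → ℕ
countV [] = 0
countV (nothing ∷ xs) = suc (countV xs)
countV (just _ ∷ xs) = countV xs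

τ : {A : Set} → S₁ A → ℕ
τ w = countV (toList (word w))

-- Strictly increasing finite sequence (encodes a finite nonempty subset of ℕ / t₁<⋯<tₘ)
StrictInc : {m : ℕ} → (Fin m → ℕ) → Set
StrictInc {m} t = ∀ (i j : Fin m) → Data.Fin._<_ i j → t i < t j

sumFin : (m : ℕ) → (Fin m → ℕ) → ℕ
sumFin zero f = 0
sumFin (suc m) f = f zero + sumFin m (λ i → f (suc i))

jprod : {A : Set} (m : ℕ) → (Fin (suc m) → S₀ A) → (Fin m → S₀ A) → S₀ A
jprod zero a b = a zero
jprod (suc m) a b = a zero ⁺++⁺ (b zero ⁺++⁺ jprod m (λ i → a (suc i)) (λ i → b (suc i)))

-- finite nonempty set of sequences: given as a nonempty list (duplicates harmless)
-- m ∈ ℕ positive: m = suc k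
IsJSet : {A : Set} → (S₀ A → Set) → Set
IsJSet {A} B =
  ∀ (F : List⁺ (ℕ → S₀ A)) →
    ∃[ k ] Σ (Fin (suc (suc k)) → S₀ A) λ a → Σ (Fin (suc k) → ℕ) λ t →
      StrictInc t ×
      (∀ f → f ∈ toList F → B (jprod (suc k) a (λ i → f (t i))))

InFS : (ℕ → ℕ) → ℕ → Set
InFS x s = ∃[ k ] Σ (Fin (suc k) → ℕ) λ h → StrictInc h × (s ≡ sumFin (suc k) (λ j → x (h j)))

-- For each n, apply the J-set property to the sequences t ↦ a^(x (t + M)), one for each
-- letter a ∈ 𝔸ₙ. The common witness a₁ f(t₁) a₂ ⋯ f(tₘ) aₘ₊₁ yields the word
-- w = a₁ v^(x (t₁ + M)) a₂ ⋯ v^(x (tₘ + M)) aₘ₊₁, so that w(a) ∈ D for every a ∈ 𝔸ₙ and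
-- τ(w) is the sum of x over the index block {tᵢ + M} ⊆ [M, N). Taking M above the previous
-- block's upper end N makes the blocks of successive words disjoint and increasing, so a sum
-- of τ(wₙ) over finitely many n is the sum of x over the union of their blocks.
module Submission where

open import Defs
open import Data.Nat using (ℕ; zero; suc; _+_; _≤_; _<_; _≤′_; ≤′-refl; ≤′-step; z≤n; s≤s)
open import Data.Nat.Properties
  using (≤-refl; ≤-trans; <⇒≤; <-trans; ≤-<-trans; +-identityʳ; +-assoc;
         +-monoˡ-<; m≤m+n; m≤n+m; n>0⇒n≢0; ≤⇒≤′)
open import Data.Fin using (Fin; zero; suc)
open import Data.Vec.Functional using (tail) renaming (_∷_ to _∷ᵥ_)
open import Data.Product using (Σ; ∃-syntax; _×_; _,_; proj₂)
open import Data.List using (List; []; _∷_; _++_)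
import Data.List as List
open import Data.List.Properties using (map-replicate)
open import Data.List.NonEmpty using (List⁺; _∷_; toList; _⁺++⁺_; replicate) renaming (map to map⁺)
open import Data.List.NonEmpty.Properties using (map-⁺++⁺; map-∘; map-id)
open import Data.List.Membership.Propositional using (_∈_)
open import Data.List.Membership.Propositional.Properties using (∈-map⁺)
open import Data.List.Relation.Unary.Any using (here)
open import Data.List.Relation.Unary.Any.Properties using (++⁺ʳ)
open import Data.Maybe using (Maybe; just; nothing; fromMaybe)
open import Data.Empty using (⊥-elim)
open import Function using (_∘_)
open import Relation.Binary.PropositionalEquality
  using (_≡_; _≢_; refl; sym; trans; cong; cong₂; subst; module ≡-Reasoning)

strictInc-∷ : ∀ {k} {y} {h : Fin (suc k) → ℕ} → y < h zero → StrictInc h → StrictInc (y ∷ᵥ h)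
strictInc-∷ y<h₀ h↑ zero    (suc zero)    _       = y<h₀
strictInc-∷ y<h₀ h↑ zero    (suc (suc j)) _       = <-trans y<h₀ (h↑ zero (suc j) (s≤s z≤n))
strictInc-∷ y<h₀ h↑ (suc i) (suc j)       (s≤s p) = h↑ i j p

strictInc-tail : ∀ {k} {h : Fin (suc k) → ℕ} → StrictInc h → StrictInc (tail h)
strictInc-tail h↑ i j p = h↑ (suc i) (suc j) (s≤s p)

sumFin-cong : ∀ m {f g : Fin m → ℕ} → (∀ i → f i ≡ g i) → sumFin m f ≡ sumFin m g
sumFin-cong zero    f≡g = refl
sumFin-cong (suc m) f≡g = cong₂ _+_ (f≡g zero) (sumFin-cong m (f≡g ∘ suc))

≤-sumFin : ∀ m (f : Fin m → ℕ) i → f i ≤ sumFin m f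
≤-sumFin (suc m) f zero    = m≤m+n (f zero) _
≤-sumFin (suc m) f (suc i) = ≤-trans (≤-sumFin m (tail f) i) (m≤n+m _ (f zero))

module _ (x : ℕ → ℕ) where

  record Block (L N s : ℕ) : Set where
    constructor block
    field
      {size}  : ℕ
      index   : Fin (suc size) → ℕ
      strict  : StrictInc index
      lower   : L ≤ index zero
      upper   : ∀ i → index i < N
      sum≡    : s ≡ sumFin (suc size) (x ∘ index)

  Block⇒InFS : ∀ {L N s} → Block L N s → InFS x s
  Block⇒InFS (block h h↑ _ _ s≡) = _ , h , h↑ , s≡

  Block-nonempty : ∀ {L N s} → Block L N s → L < N
  Block-nonempty (block _ _ L≤h₀ h<N _) = ≤-<-trans L≤h₀ (h<N zero)

  Block-weakenˡ : ∀ {L L′ N s} → L ≤ L′ → Block L′ N s → Block L N s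
  Block-weakenˡ L≤L′ (block h h↑ L′≤h₀ h<N s≡) = block h h↑ (≤-trans L≤L′ L′≤h₀) h<N s≡

  Block-cons : ∀ {L N y s} → L ≤ y → Block (suc y) N s → Block L N (x y + s)
  Block-cons {y = y} L≤y (block h h↑ y<h₀ h<N s≡) =
    block (y ∷ᵥ h) (strictInc-∷ y<h₀ h↑) L≤y upper′ (cong (x y +_) s≡)
    where
    upper′ : ∀ i → (y ∷ᵥ h) i < _
    upper′ zero    = <-trans y<h₀ (h<N zero)
    upper′ (suc i) = h<N i

  Block-prepend : ∀ {L M N t} k (h : Fin (suc k) → ℕ) → StrictInc h → L ≤ h zero → (∀ i → h i < M) →
    Block M N t → Block L N (sumFin (suc k) (x ∘ h) + t)
  Block-prepend {t = t} zero h _ L≤h₀ h<M b =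
    subst (λ s → Block _ _ (s + t)) (sym (+-identityʳ (x (h zero))))
      (Block-cons L≤h₀ (Block-weakenˡ (h<M zero) b))
  Block-prepend {t = t} (suc k) h h↑ L≤h₀ h<M b =
    subst (Block _ _) (sym (+-assoc (x (h zero)) _ t))
      (Block-cons L≤h₀ (Block-prepend k (tail h) (strictInc-tail h↑) (h↑ zero (suc zero) (s≤s z≤n))
                                      (h<M ∘ suc) b))

  Block-++ : ∀ {L M N s t} → Block L M s → Block M N t → Block L N (s + t)
  Block-++ (block h h↑ L≤h₀ h<M refl) = Block-prepend _ h h↑ L≤h₀ h<M

countV-++ : ∀ {A : Set} (us vs : List (Maybe A)) → countV (us ++ vs) ≡ countV us + countV vs
countV-++ []             vs = refl
countV-++ (nothing ∷ us) vs = cong suc (countV-++ us vs)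
countV-++ (just _ ∷ us)  vs = countV-++ us vs

countV-map-just : ∀ {A : Set} (us : List A) → countV (List.map just us) ≡ 0
countV-map-just []       = refl
countV-map-just (_ ∷ us) = countV-map-just us

countV-replicate : ∀ {A : Set} n → countV (List.replicate {A = Maybe A} n nothing) ≡ n
countV-replicate zero    = refl
countV-replicate (suc n) = cong suc (countV-replicate n)

countV-replicate⁺ : ∀ {A : Set} n (n≢0 : n ≢ 0) →
  countV (toList (replicate {A = Maybe A} n n≢0 nothing)) ≡ n
countV-replicate⁺ zero    n≢0 = ⊥-elim (n≢0 refl)
countV-replicate⁺ (suc n) _   = cong suc (countV-replicate n)

map-replicate⁺ : ∀ {A B : Set} (f : A → B) n (n≢0 : n ≢ 0) a →
  map⁺ f (replicate n n≢0 a) ≡ replicate n n≢0 (f a)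
map-replicate⁺ f n _ a = cong (f a ∷_) (map-replicate f _ a)

fromMaybe-map-just : ∀ {A : Set} (c : A) (w : List⁺ A) → map⁺ (fromMaybe c) (map⁺ just w) ≡ w
fromMaybe-map-just c w = trans (sym (map-∘ w)) (map-id w)

jprod-cong : ∀ {A : Set} m {a a′ : Fin (suc m) → S₀ A} {b b′ : Fin m → S₀ A} →
  (∀ i → a i ≡ a′ i) → (∀ i → b i ≡ b′ i) → jprod m a b ≡ jprod m a′ b′
jprod-cong zero    a≡ b≡ = a≡ zero
jprod-cong (suc m) a≡ b≡ =
  cong₂ _⁺++⁺_ (a≡ zero) (cong₂ _⁺++⁺_ (b≡ zero) (jprod-cong m (a≡ ∘ suc) (b≡ ∘ suc)))

map-jprod : ∀ {A B : Set} (f : A → B) m (a : Fin (suc m) → S₀ A) (b : Fin m → S₀ A) →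
  map⁺ f (jprod m a b) ≡ jprod m (map⁺ f ∘ a) (map⁺ f ∘ b)
map-jprod f zero    a b = refl
map-jprod f (suc m) a b = begin
  map⁺ f (a zero ⁺++⁺ (b zero ⁺++⁺ jprod m (tail a) (tail b)))
    ≡⟨ map-⁺++⁺ f (a zero) _ ⟩
  map⁺ f (a zero) ⁺++⁺ map⁺ f (b zero ⁺++⁺ jprod m (tail a) (tail b))
    ≡⟨ cong (map⁺ f (a zero) ⁺++⁺_) (map-⁺++⁺ f (b zero) _) ⟩
  map⁺ f (a zero) ⁺++⁺ (map⁺ f (b zero) ⁺++⁺ map⁺ f (jprod m (tail a) (tail b)))
    ≡⟨ cong (λ w → map⁺ f (a zero) ⁺++⁺ (map⁺ f (b zero) ⁺++⁺ w)) (map-jprod f m (tail a) (tail b)) ⟩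
  jprod (suc m) (map⁺ f ∘ a) (map⁺ f ∘ b) ∎
  where open ≡-Reasoning

module _ {A : Set} where

  countV-jprod : ∀ m (a : Fin (suc m) → S₀ A) (b : Fin m → S₀ (Maybe A)) →
    countV (toList (jprod m (map⁺ just ∘ a) b)) ≡ sumFin m (countV ∘ toList ∘ b)
  countV-jprod zero    a b = countV-map-just (toList (a zero))
  countV-jprod (suc m) a b = begin
    countV (toList (map⁺ just (a zero)) ++ (toList (b zero) ++ rest))
      ≡⟨ countV-++ (toList (map⁺ just (a zero))) _ ⟩
    countV (toList (map⁺ just (a zero))) + countV (toList (b zero) ++ rest)
      ≡⟨ cong₂ _+_ (countV-map-just (toList (a zero))) (countV-++ (toList (b zero)) rest) ⟩
    countV (toList (b zero)) + countV rest
      ≡⟨ cong (countV (toList (b zero)) +_) (countV-jprod m (tail a) (tail b)) ⟩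
    sumFin (suc m) (countV ∘ toList ∘ b) ∎
    where
    open ≡-Reasoning
    rest = toList (jprod m (map⁺ just ∘ tail a) (tail b))

  template : ∀ m (a : Fin (suc (suc m)) → S₀ A) (n : Fin (suc m) → ℕ) → (∀ i → n i ≢ 0) → S₁ A
  template m a n n≢0 = mkS₁ (jprod (suc m) (map⁺ just ∘ a) (λ i → replicate (n i) (n≢0 i) nothing))
                            (++⁺ʳ (toList (map⁺ just (a zero))) (here refl))

  subst₁-template : ∀ m a n n≢0 (c : A) →
    subst₁ (template m a n n≢0) c ≡ jprod (suc m) a (λ i → replicate (n i) (n≢0 i) c)
  subst₁-template m a n n≢0 c =
    trans (map-jprod (fromMaybe c) (suc m) (map⁺ just ∘ a) (λ i → replicate (n i) (n≢0 i) nothing))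
          (jprod-cong (suc m) (fromMaybe-map-just c ∘ a)
                      (λ i → map-replicate⁺ (fromMaybe c) (n i) (n≢0 i) nothing))

  τ-template : ∀ m a n n≢0 → τ (template m a n n≢0) ≡ sumFin (suc m) n
  τ-template m a n n≢0 =
    trans (countV-jprod (suc m) a (λ i → replicate (n i) (n≢0 i) nothing))
          (sumFin-cong (suc m) (λ i → countV-replicate⁺ {A} (n i) (n≢0 i)))

module Construction {A : Set} (𝔸 : Alphabets A) (D : S₀ A → Set) (D-J : IsJSet D)
                    (x : ℕ → ℕ) (x≥1 : ∀ n → 1 ≤ x n) where

  open Alphabets 𝔸 using (alph)

  x≢0 : ∀ n → x n ≢ 0
  x≢0 = n>0⇒n≢0 ∘ x≥1

  record Stage (n M : ℕ) : Set where
    field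
      w      : S₁ A
      w[𝔸]∈D : ∀ a → a ∈ toList (alph n) → D (subst₁ w a)
      next   : ℕ
      τw     : Block x M next (τ w)

  shiftedPower : ℕ → A → ℕ → S₀ A
  shiftedPower M a t = replicate (x (t + M)) (x≢0 (t + M)) a

  stage : ∀ n M → Stage n M
  stage n M with D-J (map⁺ (shiftedPower M) (alph n))
  ... | k , a , t , t↑ , a[f]∈D = record
    { w      = template k a (x ∘ h) (x≢0 ∘ h)
    ; w[𝔸]∈D = λ c c∈ → subst D (sym (subst₁-template k a (x ∘ h) (x≢0 ∘ h) c))
                                 (a[f]∈D (shiftedPower M c) (∈-map⁺ (shiftedPower M) c∈))
    ; next   = suc (sumFin (suc k) h)
    ; τw     = block h (λ i j i<j → +-monoˡ-< M (t↑ i j i<j)) (m≤n+m M (t zero))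
                       (λ i → s≤s (≤-sumFin (suc k) h i)) (τ-template k a (x ∘ h) (x≢0 ∘ h))
    }
    where
    h : Fin (suc k) → ℕ
    h i = t i + M

  bound : ℕ → ℕ
  bound zero    = 0
  bound (suc n) = Stage.next (stage n (bound n))

  stageₙ : ∀ n → Stage n (bound n)
  stageₙ n = stage n (bound n)

  w : ℕ → S₁ A
  w n = Stage.w (stageₙ n)

  bound-mono : ∀ {m n} → m ≤′ n → bound m ≤ bound n
  bound-mono ≤′-refl                 = ≤-refl
  bound-mono {n = suc n} (≤′-step p) =
    ≤-trans (bound-mono p) (<⇒≤ (Block-nonempty x (Stage.τw (stageₙ n))))

  τ-sum-block : ∀ k (g : Fin (suc k) → ℕ) → StrictInc g →
    ∃[ N ] Block x (bound (g zero)) N (sumFin (suc k) (τ ∘ w ∘ g))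
  τ-sum-block zero    g _  =
    _ , subst (Block x _ _) (sym (+-identityʳ _)) (Stage.τw (stageₙ (g zero)))
  τ-sum-block (suc k) g g↑ with τ-sum-block k (tail g) (strictInc-tail g↑)
  ... | N , rest = N , Block-++ x (Stage.τw (stageₙ (g zero)))
                         (Block-weakenˡ x (bound-mono (≤⇒≤′ (g↑ zero (suc zero) (s≤s z≤n)))) rest)

mainTheorem5 : (A : Set) (𝔸 : Alphabets A) (D : S₀ A → Set) → IsJSet D →
    (x : ℕ → ℕ) → (∀ n → 1 ≤ x n) →
    Σ (ℕ → S₁ A) λ w →
      (∀ n (a : A) → a ∈ toList (Alphabets.alph 𝔸 n) → D (subst₁ (w n) a)) ×
      (∀ k (g : Fin (suc k) → ℕ) → StrictInc g →
        InFS x (sumFin (suc k) (λ i → τ (w (g i)))))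
mainTheorem5 A 𝔸 D D-J x x≥1 =
  w , (λ n → Stage.w[𝔸]∈D (stageₙ n)) , (λ k g g↑ → Block⇒InFS x (proj₂ (τ-sum-block k g g↑)))
  where open Construction 𝔸 D D-J x x≥1
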